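{- $W(9,3) > 559$; that is, there exists a coloring of $\{1,2,\dots,559\}$ with $9$ colors containing no monochromatic arithmetic progression of length $3$.
   Context: For positive integers $r$ and $k$, the van der Waerden number $W(r,k)$ is the smallest positive integer $N$ such that for every coloring of the integers $\{1,2,\dots,N\}$ with $r$ colors there exist $k$ integers in arithmetic progression (with nonzero common difference) all of the same color. (Its existence is van der Waerden's theorem.) -}

module Defs where

open import Data.Nat using (ℕ; zero; suc; _+_; _*_; _∸_; _≤_; _<_)
open import Data.Fin using (Fin)
open import Data.Product using (Σ; _×_; ∃-syntax)
open import Relation.Binary.PropositionalEquality using (_≡_)
open import Relation.Nullary using (¬_)

-- An r-coloring of {1,...,N}: a map ℕ → Fin r; only its values on 1..N matter.
Coloring : ℕ → Set
Coloring r = ℕ → Fin r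

HasMonoAP : (r k N : ℕ) → Coloring r → Set
HasMonoAP r k N c =
  ∃[ a ] ∃[ d ] (1 ≤ d × 1 ≤ a × a + (k ∸ 1) * d ≤ N ×
    ((i : ℕ) → i < k → c (a + i * d) ≡ c a))

WGreater : (r k N : ℕ) → Set
WGreater r k N = ∃[ c ] ¬ HasMonoAP r k N c

module Submission where

-- Colour n by the colour of n mod 307 in a 9-colouring of ℤ/307 that has no monochromatic
-- progression x, x + d, x + 2d with d ≢ 0 (mod 307); this cyclic property is checked by evaluation.
-- An integer progression a, a + d, a + 2d in {1, …, N} reduces modulo 307 to such a cyclic one
-- unless 307 ∣ d, and then a + 2d ≥ 1 + 2 · 307 > N as long as N ≤ 614.

open import Defs
open import Data.Nat using (ℕ; _+_; _*_; _∸_; _≤_; _<_; _%_; _<?_; NonZero; >-nonZero)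
open import Data.Nat.Properties
  using (_≟_; allUpTo?; ≤-trans; +-mono-≤; *-monoʳ-≤; <-irrefl; n≢0⇒n>0; m≤m+n)
open import Data.Nat.DivMod
  using (_mod_; %-distribˡ-+; %-distribˡ-*; m%n%n≡m%n; m%n<n)
open import Data.Nat.Divisibility using (∣⇒≤; m%n≡0⇒n∣m)
import Data.Fin.Properties as Fin
open import Data.Vec using (Vec; []; _∷_; lookup)
open import Data.Product using (_,_)
open import Relation.Nullary using (¬_; Dec; yes; no; ¬?; _→-dec_)
open import Relation.Nullary.Decidable using (toWitness)
open import Relation.Binary.PropositionalEquality using (_≡_; refl; cong; cong₂; module ≡-Reasoning)

module _ (p : ℕ) .{{_ : NonZero p}} where

  [m%p+k*[n%p]]%p≡[m+k*n]%p : ∀ m k n → (m % p + k * (n % p)) % p ≡ (m + k * n) % p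
  [m%p+k*[n%p]]%p≡[m+k*n]%p m k n = begin
    (m % p + k * (n % p)) % p                 ≡⟨ %-distribˡ-+ (m % p) (k * (n % p)) p ⟩
    (m % p % p + k * (n % p) % p) % p         ≡⟨ cong₂ (λ u v → (u + v) % p) (m%n%n≡m%n m p) k*[n%p]%p≡k*n%p ⟩
    (m % p + k * n % p) % p                   ≡⟨ %-distribˡ-+ m (k * n) p ⟨
    (m + k * n) % p                           ∎
    where
    open ≡-Reasoning
    k*[n%p]%p≡k*n%p : k * (n % p) % p ≡ k * n % p
    k*[n%p]%p≡k*n%p = begin
      k * (n % p) % p                         ≡⟨ %-distribˡ-* k (n % p) p ⟩
      (k % p * (n % p % p)) % p               ≡⟨ cong (λ u → (k % p * u) % p) (m%n%n≡m%n n p) ⟩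
      (k % p * (n % p)) % p                   ≡⟨ %-distribˡ-* k n p ⟨
      k * n % p                               ∎

  module _ {r : ℕ} (c : Coloring r) where

    Periodic : Set
    Periodic = ∀ m n → m % p ≡ n % p → c m ≡ c n

    CyclicAPFree : ℕ → Set
    CyclicAPFree k = ∀ {x} → x < p → ∀ {d} → d < p → 0 < d →
      ¬ (∀ {i} → i < k → c (x + i * d) ≡ c x)

    cyclicAPFree? : ∀ k → Dec (CyclicAPFree k)
    cyclicAPFree? k = allUpTo? (λ x → allUpTo? (λ d →
      0 <? d →-dec ¬? (allUpTo? (λ i → c (x + i * d) Fin.≟ c x) k)) p) p

    periodic∧cyclicAPFree⇒¬HasMonoAP : ∀ {k N} → Periodic → CyclicAPFree k →
                                       N ≤ (k ∸ 1) * p → ¬ HasMonoAP r k N c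
    periodic∧cyclicAPFree⇒¬HasMonoAP {k} {N} periodic free N≤[k-1]p
                                     (a , d , 1≤d , 1≤a , end≤N , mono)
      with d % p ≟ 0
    ... | yes d%p≡0 =
      <-irrefl refl (≤-trans (+-mono-≤ 1≤a (*-monoʳ-≤ (k ∸ 1) p≤d)) (≤-trans end≤N N≤[k-1]p))
      where
      p≤d : p ≤ d
      p≤d = ∣⇒≤ ⦃ >-nonZero 1≤d ⦄ (m%n≡0⇒n∣m d p d%p≡0)
    ... | no d%p≢0 = free (m%n<n a p) (m%n<n d p) (n≢0⇒n>0 d%p≢0) reducedMono
      where
      reducedMono : ∀ {i} → i < k → c (a % p + i * (d % p)) ≡ c (a % p)
      reducedMono {i} i<k = begin
        c (a % p + i * (d % p))               ≡⟨ periodic _ _ ([m%p+k*[n%p]]%p≡[m+k*n]%p a i d) ⟩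
        c (a + i * d)                         ≡⟨ mono i i<k ⟩
        c a                                   ≡⟨ periodic _ _ (m%n%n≡m%n a p) ⟨
        c (a % p)                             ∎
        where open ≡-Reasoning

table : Vec ℕ 307
table =
  0 ∷ 0 ∷ 3 ∷ 8 ∷ 1 ∷ 1 ∷ 7 ∷ 3 ∷ 8 ∷ 0 ∷
  4 ∷ 4 ∷ 2 ∷ 1 ∷ 6 ∷ 5 ∷ 7 ∷ 1 ∷ 3 ∷ 1 ∷
  7 ∷ 4 ∷ 7 ∷ 4 ∷ 0 ∷ 2 ∷ 4 ∷ 8 ∷ 8 ∷ 6 ∷
  0 ∷ 5 ∷ 2 ∷ 0 ∷ 8 ∷ 8 ∷ 1 ∷ 4 ∷ 8 ∷ 5 ∷
  5 ∷ 3 ∷ 2 ∷ 0 ∷ 5 ∷ 1 ∷ 2 ∷ 4 ∷ 3 ∷ 6 ∷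
  5 ∷ 2 ∷ 7 ∷ 5 ∷ 7 ∷ 5 ∷ 4 ∷ 2 ∷ 8 ∷ 5 ∷
  6 ∷ 6 ∷ 3 ∷ 3 ∷ 0 ∷ 2 ∷ 6 ∷ 0 ∷ 7 ∷ 3 ∷
  7 ∷ 2 ∷ 8 ∷ 0 ∷ 7 ∷ 6 ∷ 7 ∷ 7 ∷ 0 ∷ 7 ∷
  0 ∷ 0 ∷ 6 ∷ 8 ∷ 5 ∷ 7 ∷ 6 ∷ 2 ∷ 0 ∷ 5 ∷
  4 ∷ 8 ∷ 5 ∷ 8 ∷ 2 ∷ 7 ∷ 1 ∷ 7 ∷ 1 ∷ 4 ∷
  3 ∷ 1 ∷ 0 ∷ 7 ∷ 5 ∷ 0 ∷ 0 ∷ 2 ∷ 2 ∷ 6 ∷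
  3 ∷ 0 ∷ 2 ∷ 1 ∷ 0 ∷ 0 ∷ 4 ∷ 1 ∷ 3 ∷ 8 ∷
  1 ∷ 3 ∷ 8 ∷ 4 ∷ 6 ∷ 3 ∷ 6 ∷ 6 ∷ 3 ∷ 4 ∷
  5 ∷ 7 ∷ 1 ∷ 8 ∷ 6 ∷ 5 ∷ 2 ∷ 1 ∷ 6 ∷ 4 ∷
  2 ∷ 3 ∷ 5 ∷ 5 ∷ 7 ∷ 7 ∷ 6 ∷ 7 ∷ 5 ∷ 1 ∷
  8 ∷ 7 ∷ 2 ∷ 1 ∷ 2 ∷ 1 ∷ 6 ∷ 5 ∷ 2 ∷ 1 ∷
  6 ∷ 7 ∷ 3 ∷ 3 ∷ 8 ∷ 8 ∷ 4 ∷ 1 ∷ 3 ∷ 2 ∷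
  5 ∷ 1 ∷ 1 ∷ 7 ∷ 5 ∷ 5 ∷ 6 ∷ 8 ∷ 0 ∷ 7 ∷
  7 ∷ 2 ∷ 7 ∷ 2 ∷ 3 ∷ 5 ∷ 4 ∷ 5 ∷ 5 ∷ 4 ∷
  5 ∷ 3 ∷ 8 ∷ 8 ∷ 2 ∷ 6 ∷ 4 ∷ 4 ∷ 7 ∷ 1 ∷
  6 ∷ 4 ∷ 8 ∷ 1 ∷ 3 ∷ 8 ∷ 2 ∷ 4 ∷ 0 ∷ 5 ∷
  3 ∷ 2 ∷ 6 ∷ 6 ∷ 5 ∷ 8 ∷ 0 ∷ 0 ∷ 1 ∷ 4 ∷
  6 ∷ 7 ∷ 6 ∷ 8 ∷ 5 ∷ 2 ∷ 8 ∷ 4 ∷ 3 ∷ 4 ∷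
  3 ∷ 3 ∷ 2 ∷ 6 ∷ 4 ∷ 0 ∷ 6 ∷ 3 ∷ 4 ∷ 3 ∷
  4 ∷ 7 ∷ 6 ∷ 8 ∷ 4 ∷ 4 ∷ 2 ∷ 7 ∷ 8 ∷ 5 ∷
  1 ∷ 3 ∷ 8 ∷ 3 ∷ 1 ∷ 6 ∷ 1 ∷ 8 ∷ 7 ∷ 7 ∷
  3 ∷ 6 ∷ 5 ∷ 1 ∷ 4 ∷ 6 ∷ 4 ∷ 1 ∷ 1 ∷ 0 ∷
  0 ∷ 2 ∷ 0 ∷ 0 ∷ 4 ∷ 1 ∷ 8 ∷ 4 ∷ 2 ∷ 5 ∷
  0 ∷ 0 ∷ 6 ∷ 8 ∷ 3 ∷ 6 ∷ 3 ∷ 6 ∷ 2 ∷ 7 ∷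
  2 ∷ 3 ∷ 1 ∷ 2 ∷ 5 ∷ 1 ∷ 0 ∷ 0 ∷ 8 ∷ 0 ∷
  4 ∷ 3 ∷ 5 ∷ 2 ∷ 0 ∷ 7 ∷ 8 ∷ []

colour : Coloring 9
colour n = lookup table (n mod 307) mod 9

colour-periodic : Periodic 307 colour
colour-periodic m n m%307≡n%307 =
  cong (λ i → lookup table i mod 9) (Fin.fromℕ<-cong (m % 307) (n % 307) m%307≡n%307 _ _)

colour-cyclicAPFree : CyclicAPFree 307 colour 3
colour-cyclicAPFree = toWitness {a? = cyclicAPFree? 307 colour 3} _

mainTheorem3 : WGreater 9 3 559
mainTheorem3 =
  colour , periodic∧cyclicAPFree⇒¬HasMonoAP 307 colour colour-periodic colour-cyclicAPFree 559≤2*307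
  where
  559≤2*307 : 559 ≤ 2 * 307
  559≤2*307 = m≤m+n 559 55
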